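{- Let $F(x,y)=\sum_{n\ge1}\sum_{k\ge1} d_i(P_n,k)\,x^n y^k$ (formal power series). Then \[F(x,y)=\frac{x(1+x)^2y}{1-(x^2+x^3)y}.\]
   Context: $P_n$ is the path on $n$ vertices. A set $S$ of vertices is an independent dominating set if no two vertices of $S$ are adjacent and every vertex outside $S$ has a neighbour in $S$; $d_i(P_n,k)$ is the number of independent dominating sets of $P_n$ of size $k$. -}

module Defs where

open import Data.Nat as ℕ using (ℕ; zero; suc; _≡ᵇ_)
open import Data.Bool using (Bool; true; false; _∧_; _∨_; not)
open import Data.Fin using (Fin; toℕ)
open import Data.Fin.Subset using (Subset; ∣_∣)
open import Data.Vec using ([]; _∷_; lookup)
open import Data.List using (List; []; _∷_; map; _++_; filterᵇ; length; allFin)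
open import Data.Bool.ListAction using (all; any)
open import Data.Integer as ℤ using (ℤ; +_; 0ℤ; 1ℤ)

adjP : ∀ {n} → Fin n → Fin n → Bool
adjP i j = (suc (toℕ i) ≡ᵇ toℕ j) ∨ (suc (toℕ j) ≡ᵇ toℕ i)

independentᵇ : ∀ {n} → Subset n → Bool
independentᵇ {n} S =
  all (λ i → all (λ j → not (lookup S i ∧ lookup S j ∧ adjP i j)) (allFin n)) (allFin n)

dominatingᵇ : ∀ {n} → Subset n → Bool
dominatingᵇ {n} S =
  all (λ v → lookup S v ∨ any (λ u → lookup S u ∧ adjP u v) (allFin n)) (allFin n)

isIndDomᵇ : ∀ {n} → Subset n → Bool
isIndDomᵇ S = independentᵇ S ∧ dominatingᵇ S

subsets : (n : ℕ) → List (Subset n)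
subsets zero    = [] ∷ []
subsets (suc n) = map (true ∷_) (subsets n) ++ map (false ∷_) (subsets n)

di : ℕ → ℕ → ℕ
di n k = length (filterᵇ (λ S → isIndDomᵇ S ∧ (∣ S ∣ ≡ᵇ k)) (subsets n))

-- Formal power series in x, y with integer coefficients:
-- f n k is the coefficient of x^n y^k.

PS : Set
PS = ℕ → ℕ → ℤ

sumTo : ℕ → (ℕ → ℤ) → ℤ
sumTo zero    f = f zero
sumTo (suc n) f = sumTo n f ℤ.+ f (suc n)

_⊕_ : PS → PS → PS
(f ⊕ g) n k = f n k ℤ.+ g n k

_⊖_ : PS → PS → PS
(f ⊖ g) n k = f n k ℤ.- g n k

_⊛_ : PS → PS → PS
(f ⊛ g) n k = sumTo n (λ a → sumTo k (λ b → f a b ℤ.* g (n ℕ.∸ a) (k ℕ.∸ b)))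

infixl 6 _⊕_ _⊖_
infixl 7 _⊛_

one : PS
one zero zero = 1ℤ
one _    _    = 0ℤ

X : PS
X 1 zero = 1ℤ
X _ _    = 0ℤ

Y : PS
Y zero 1 = 1ℤ
Y _ _    = 0ℤ

F : PS
F zero    _       = 0ℤ
F (suc n) zero    = 0ℤ
F (suc n) (suc k) = + di (suc n) (suc k)

numer : PS
numer = X ⊛ (one ⊕ X) ⊛ (one ⊕ X) ⊛ Y

denom : PS
denom = one ⊖ (X ⊛ X ⊕ X ⊛ X ⊛ X) ⊛ Y

module Submission where

-- Write Q = x(1+x)² y and D = 1 − (x²+x³) y.  Multiplying
-- by x or by y merely shifts coefficients, so F·D = F − y(x²F + x³F) and
-- Q = y·(x(1+x) + x·x(1+x)) coefficientwise.  Comparing coefficients of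
-- x^n y^k, the identity F·D = Q becomes the recurrence
--     d_i(P_{m+4}, k+1) = d_i(P_{m+2}, k) + d_i(P_{m+1}, k)
-- together with d_i(P_{m+1}, 0) = 0 and the values for paths with at most
-- three vertices, which are checked by evaluation.

open import Defs
open import Data.Nat as ℕ using (ℕ; zero; suc; _≤_; _∸_; _+_; _≡ᵇ_; z≤n)
import Data.Nat.Properties as ℕP
open import Data.Integer as ℤ using (ℤ; +_; 0ℤ; -_)
import Data.Integer.Properties as ℤP
open import Data.Bool using (Bool; true; false; _∧_; _∨_; not; T)
open import Data.Bool.Properties using (∧-commutativeMonoid; ∧-zeroʳ; T?)
open import Data.Bool.ListAction using (and; or; all; any)
open import Data.Fin using (Fin; zero; suc)
open import Data.Fin.Subset using (Subset; ∣_∣)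
open import Data.Vec using ([]; _∷_; lookup)
open import Data.List using ([]; _∷_; map; _++_; allFin; filterᵇ; length)
open import Data.List.Properties
  using (map-tabulate; map-cong; length-++; filter-++; filter-≐; filter-none)
open import Data.List.Relation.Unary.All using (universal)
open import Data.Product using (_,_)
open import Algebra.Bundles using (CommutativeMonoid)
open import Algebra.Properties.CommutativeSemigroup ℤP.+-commutativeSemigroup
  using () renaming (interchange to +-interchange)
open import Algebra.Properties.CommutativeSemigroup
  (CommutativeMonoid.commutativeSemigroup ∧-commutativeMonoid)
  using () renaming (interchange to ∧-interchange)
open import Function using (_∘_)
open import Level using (0ℓ)
open import Relation.Binary.Bundles using (Setoid)
open import Relation.Binary.PropositionalEquality
import Relation.Binary.Reasoning.Setoid

-- Part (1): the algebra of power series.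

-- Coefficientwise equality of series; a record, so that both sides can
-- be inferred when chaining equalities.
record _≐_ (f g : PS) : Set where
  constructor coeffwise
  field coeff : ∀ n k → f n k ≡ g n k
open _≐_

infix 4 _≐_

≐-refl : ∀ {f} → f ≐ f
≐-refl = coeffwise λ _ _ → refl

≐-sym : ∀ {f g} → f ≐ g → g ≐ f
≐-sym e = coeffwise λ n k → sym (coeff e n k)

≐-trans : ∀ {f g h} → f ≐ g → g ≐ h → f ≐ h
≐-trans e e′ = coeffwise λ n k → trans (coeff e n k) (coeff e′ n k)

≐-setoid : Setoid 0ℓ 0ℓ
≐-setoid = record
  { Carrier       = PS
  ; _≈_           = _≐_
  ; isEquivalence = record { refl = ≐-refl ; sym = ≐-sym ; trans = ≐-trans }
  }

module ≐-Reasoning = Relation.Binary.Reasoning.Setoid ≐-setoid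

sumTo-cong : ∀ n {f g : ℕ → ℤ} → (∀ a → a ≤ n → f a ≡ g a) → sumTo n f ≡ sumTo n g
sumTo-cong zero    e = e 0 z≤n
sumTo-cong (suc n) e =
  cong₂ ℤ._+_ (sumTo-cong n λ a a≤n → e a (ℕP.m≤n⇒m≤1+n a≤n)) (e (suc n) ℕP.≤-refl)

sumTo-zero : ∀ n {f : ℕ → ℤ} → (∀ a → a ≤ n → f a ≡ 0ℤ) → sumTo n f ≡ 0ℤ
sumTo-zero zero    e = e 0 z≤n
sumTo-zero (suc n) e =
  cong₂ ℤ._+_ (sumTo-zero n λ a a≤n → e a (ℕP.m≤n⇒m≤1+n a≤n)) (e (suc n) ℕP.≤-refl)

sumTo-+ : ∀ n (f g : ℕ → ℤ) → sumTo n (λ a → f a ℤ.+ g a) ≡ sumTo n f ℤ.+ sumTo n g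
sumTo-+ zero    f g = refl
sumTo-+ (suc n) f g =
  trans (cong (ℤ._+ (f (suc n) ℤ.+ g (suc n))) (sumTo-+ n f g))
        (+-interchange (sumTo n f) (sumTo n g) (f (suc n)) (g (suc n)))

sumTo-neg : ∀ n (f : ℕ → ℤ) → sumTo n (λ a → - f a) ≡ - sumTo n f
sumTo-neg zero    f = refl
sumTo-neg (suc n) f =
  trans (cong (ℤ._+ (- f (suc n))) (sumTo-neg n f))
        (sym (ℤP.neg-distrib-+ (sumTo n f) (f (suc n))))

sumTo-*0 : ∀ n (f : ℕ → ℤ) → sumTo n (λ a → f a ℤ.* 0ℤ) ≡ 0ℤ
sumTo-*0 n f = sumTo-zero n λ a _ → ℤP.*-zeroʳ (f a)

sumTo-diagonal : ∀ n (h g : ℕ → ℤ) → (∀ j → g (suc j) ≡ 0ℤ) →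
                 sumTo n (λ a → h a ℤ.* g (n ∸ a)) ≡ h n ℤ.* g 0
sumTo-diagonal zero    h g g-supp = refl
sumTo-diagonal (suc n) h g g-supp =
  trans (cong₂ ℤ._+_ (sumTo-zero n off-diagonal) (cong (λ j → h (suc n) ℤ.* g j) (ℕP.n∸n≡0 n)))
        (ℤP.+-identityˡ _)
  where
  off-diagonal : ∀ a → a ≤ n → h a ℤ.* g (suc n ∸ a) ≡ 0ℤ
  off-diagonal a a≤n = begin
    h a ℤ.* g (suc n ∸ a)    ≡⟨ cong (λ j → h a ℤ.* g j) (ℕP.+-∸-assoc 1 a≤n) ⟩
    h a ℤ.* g (suc (n ∸ a))  ≡⟨ cong (h a ℤ.*_) (g-supp (n ∸ a)) ⟩
    h a ℤ.* 0ℤ               ≡⟨ ℤP.*-zeroʳ (h a) ⟩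
    0ℤ                       ∎
    where open ≡-Reasoning

sumTo-shift : ∀ n (t : ℕ → ℕ → ℤ) → (∀ a → t a 0 ≡ 0ℤ) →
              sumTo (suc n) (λ a → t a (suc n ∸ a)) ≡ sumTo n (λ a → t a (suc (n ∸ a)))
sumTo-shift n t t-0 =
  trans (cong₂ ℤ._+_ (sumTo-cong n λ a a≤n → cong (t a) (ℕP.+-∸-assoc 1 a≤n))
                     (trans (cong (t (suc n)) (ℕP.n∸n≡0 n)) (t-0 (suc n))))
        (ℤP.+-identityʳ _)

shift : (ℕ → ℤ) → ℕ → ℤ
shift u zero    = 0ℤ
shift u (suc j) = u j

-- shX f = x·f and shY f = y·f, defined directly on coefficients.
shX : PS → PS
shX f n k = shift (λ m → f m k) n

shY : PS → PS
shY f n k = shift (f n) k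

shX-cong : ∀ {f g} → f ≐ g → shX f ≐ shX g
shX-cong e = coeffwise λ where
  zero    k → refl
  (suc n) k → coeff e n k

shY-cong : ∀ {f g} → f ≐ g → shY f ≐ shY g
shY-cong e = coeffwise λ where
  n zero    → refl
  n (suc k) → coeff e n k

⊕-cong : ∀ {f f′ g g′} → f ≐ f′ → g ≐ g′ → f ⊕ g ≐ f′ ⊕ g′
⊕-cong e e′ = coeffwise λ n k → cong₂ ℤ._+_ (coeff e n k) (coeff e′ n k)

⊖-cong : ∀ {f f′ g g′} → f ≐ f′ → g ≐ g′ → f ⊖ g ≐ f′ ⊖ g′
⊖-cong e e′ = coeffwise λ n k → cong₂ ℤ._-_ (coeff e n k) (coeff e′ n k)

⊛-congˡ : ∀ f {g h} → g ≐ h → f ⊛ g ≐ f ⊛ h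
⊛-congˡ f e = coeffwise λ n k →
  sumTo-cong n λ a _ → sumTo-cong k λ b _ → cong (f a b ℤ.*_) (coeff e _ _)

⊛-distribˡ-⊕ : ∀ f g h → f ⊛ (g ⊕ h) ≐ f ⊛ g ⊕ f ⊛ h
⊛-distribˡ-⊕ f g h = coeffwise λ n k →
  trans (sumTo-cong n λ a _ →
           trans (sumTo-cong k λ b _ → ℤP.*-distribˡ-+ (f a b) _ _) (sumTo-+ k _ _))
        (sumTo-+ n _ _)

⊛-distribˡ-⊖ : ∀ f g h → f ⊛ (g ⊖ h) ≐ f ⊛ g ⊖ f ⊛ h
⊛-distribˡ-⊖ f g h = coeffwise λ n k →
  trans (coeff (⊛-distribˡ-⊕ f g (λ n k → - h n k)) n k)
        (cong (λ t → (f ⊛ g) n k ℤ.+ t) (neg-inside n k))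
  where
  neg-inside : ∀ n k → (f ⊛ (λ n k → - h n k)) n k ≡ - (f ⊛ h) n k
  neg-inside n k =
    trans (sumTo-cong n λ a _ →
             trans (sumTo-cong k λ b _ → sym (ℤP.neg-distribʳ-* (f a b) _)) (sumTo-neg k _))
          (sumTo-neg n _)

one-supported : ∀ m j → one m (suc j) ≡ 0ℤ
one-supported zero    j = refl
one-supported (suc m) j = refl

⊛-identityʳ : ∀ f → f ⊛ one ≐ f
⊛-identityʳ f = coeffwise λ n k →
  trans (sumTo-cong n λ a _ → sumTo-diagonal k (f a) (one (n ∸ a)) (one-supported (n ∸ a)))
        (trans (sumTo-diagonal n (λ a → f a k) (λ j → one j 0) (λ j → refl))
               (ℤP.*-identityʳ (f n k)))

⊛-shX : ∀ f g → f ⊛ shX g ≐ shX (f ⊛ g)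
⊛-shX f g = coeffwise λ where
  zero    k → sumTo-*0 k (f 0)
  (suc n) k → sumTo-shift n (λ a m → sumTo k λ b → f a b ℤ.* shX g m (k ∸ b))
                            (λ a → sumTo-*0 k (f a))

⊛-shY : ∀ f g → f ⊛ shY g ≐ shY (f ⊛ g)
⊛-shY f g = coeffwise λ where
  n zero    → sumTo-zero n λ a _ → ℤP.*-zeroʳ (f a 0)
  n (suc k) → sumTo-cong n λ a _ →
    sumTo-shift k (λ b m → f a b ℤ.* shY g (n ∸ a) m) (λ b → ℤP.*-zeroʳ (f a b))

X-shift : X ≐ shX one
X-shift = coeffwise λ where
  zero          k       → refl
  1             zero    → refl
  1             (suc k) → refl
  (suc (suc n)) k       → refl

Y-shift : Y ≐ shY one
Y-shift = coeffwise λ where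
  zero    zero          → refl
  (suc n) zero          → refl
  zero    (suc zero)    → refl
  zero    (suc (suc k)) → refl
  (suc n) (suc k)       → refl

⊛-X : ∀ f → f ⊛ X ≐ shX f
⊛-X f = begin
  f ⊛ X          ≈⟨ ⊛-congˡ f X-shift ⟩
  f ⊛ shX one    ≈⟨ ⊛-shX f one ⟩
  shX (f ⊛ one)  ≈⟨ shX-cong (⊛-identityʳ f) ⟩
  shX f          ∎
  where open ≐-Reasoning

⊛-Y : ∀ f → f ⊛ Y ≐ shY f
⊛-Y f = begin
  f ⊛ Y          ≈⟨ ⊛-congˡ f Y-shift ⟩
  f ⊛ shY one    ≈⟨ ⊛-shY f one ⟩
  shY (f ⊛ one)  ≈⟨ shY-cong (⊛-identityʳ f) ⟩
  shY f          ∎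
  where open ≐-Reasoning

-- Part (2): independent dominating sets of paths.

all-allFin-suc : ∀ {n} (p : Fin (suc n) → Bool) →
                 all p (allFin (suc n)) ≡ p zero ∧ all (p ∘ suc) (allFin n)
all-allFin-suc {n} p =
  cong (λ bs → p zero ∧ and bs)
       (trans (map-tabulate suc p) (sym (map-tabulate (λ i → i) (p ∘ suc))))

any-allFin-suc : ∀ {n} (p : Fin (suc n) → Bool) →
                 any p (allFin (suc n)) ≡ p zero ∨ any (p ∘ suc) (allFin n)
any-allFin-suc {n} p =
  cong (λ bs → p zero ∨ or bs)
       (trans (map-tabulate suc p) (sym (map-tabulate (λ i → i) (p ∘ suc))))

all-cong : ∀ {A : Set} {p q : A → Bool} → (∀ x → p x ≡ q x) → ∀ xs → all p xs ≡ all q xs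
all-cong e xs = cong and (map-cong e xs)

all-true : ∀ {A : Set} {p : A → Bool} → (∀ x → p x ≡ true) → ∀ xs → all p xs ≡ true
all-true e []       = refl
all-true e (x ∷ xs) = cong₂ _∧_ (e x) (all-true e xs)

any-false : ∀ {A : Set} {p : A → Bool} → (∀ x → p x ≡ false) → ∀ xs → any p xs ≡ false
any-false e []       = refl
any-false e (x ∷ xs) = cong₂ _∨_ (e x) (any-false e xs)

all-∧ : ∀ {A : Set} (p q : A → Bool) xs → all (λ x → p x ∧ q x) xs ≡ all p xs ∧ all q xs
all-∧ p q []       = refl
all-∧ p q (x ∷ xs) =
  trans (cong ((p x ∧ q x) ∧_) (all-∧ p q xs)) (∧-interchange (p x) (q x) (all p xs) (all q xs))

noTwoConsecutive : ∀ {n} → Subset n → Bool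
noTwoConsecutive []          = true
noTwoConsecutive (b ∷ [])    = true
noTwoConsecutive (b ∷ c ∷ S) = not (b ∧ c) ∧ noTwoConsecutive (c ∷ S)

-- Peeling off the first vertex: its only neighbour is the second one.
independent-cons₂ : ∀ {n} b c (S : Subset n) →
                    independentᵇ (b ∷ c ∷ S) ≡ not (b ∧ c) ∧ independentᵇ (c ∷ S)
independent-cons₂ {n} b c S = begin
  independentᵇ (b ∷ c ∷ S)
    ≡⟨ all-allFin-suc (λ i → all (conflict i) (allFin (2 + n))) ⟩
  all (conflict zero) (allFin (2 + n)) ∧ all (λ i → all (conflict (suc i)) (allFin (2 + n))) (allFin (1 + n))
    ≡⟨ cong₂ _∧_ row₀ (all-cong (λ i → all-allFin-suc (conflict (suc i))) (allFin (1 + n))) ⟩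
  not (b ∧ c) ∧ all (λ i → conflict (suc i) zero ∧ all (conflict (suc i) ∘ suc) (allFin (1 + n))) (allFin (1 + n))
    ≡⟨ cong (not (b ∧ c) ∧_) (all-∧ (λ i → conflict (suc i) zero) _ (allFin (1 + n))) ⟩
  not (b ∧ c) ∧ (all (λ i → conflict (suc i) zero) (allFin (1 + n)) ∧ independentᵇ (c ∷ S))
    ≡⟨ cong (λ t → not (b ∧ c) ∧ (t ∧ independentᵇ (c ∷ S))) column₀ ⟩
  not (b ∧ c) ∧ (not (c ∧ b) ∧ independentᵇ (c ∷ S))
    ≡⟨ absorb b c (independentᵇ (c ∷ S)) ⟩
  not (b ∧ c) ∧ independentᵇ (c ∷ S)
    ∎
  where
  open ≡-Reasoning
  conflict : Fin (2 + n) → Fin (2 + n) → Bool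
  conflict i j = not (lookup (b ∷ c ∷ S) i ∧ lookup (b ∷ c ∷ S) j ∧ adjP i j)

  not-∧-false : ∀ x y → not (x ∧ y ∧ false) ≡ true
  not-∧-false false y     = refl
  not-∧-false true  false = refl
  not-∧-false true  true  = refl

  row₀ : all (conflict zero) (allFin (2 + n)) ≡ not (b ∧ c)
  row₀ = begin
    all (conflict zero) (allFin (2 + n))
      ≡⟨ all-allFin-suc (conflict zero) ⟩
    conflict zero zero ∧ all (conflict zero ∘ suc) (allFin (1 + n))
      ≡⟨ cong (conflict zero zero ∧_) (all-allFin-suc (conflict zero ∘ suc)) ⟩
    not (b ∧ b ∧ false) ∧ (not (b ∧ c ∧ true) ∧ all (λ j → conflict zero (suc (suc j))) (allFin n))
      ≡⟨ cong (λ t → not (b ∧ b ∧ false) ∧ (not (b ∧ c ∧ true) ∧ t))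
              (all-true (λ j → not-∧-false b (lookup S j)) (allFin n)) ⟩
    not (b ∧ b ∧ false) ∧ (not (b ∧ c ∧ true) ∧ true)
      ≡⟨ tidy b c ⟩
    not (b ∧ c)
      ∎
    where
    tidy : ∀ b c → not (b ∧ b ∧ false) ∧ (not (b ∧ c ∧ true) ∧ true) ≡ not (b ∧ c)
    tidy false c     = refl
    tidy true  false = refl
    tidy true  true  = refl

  column₀ : all (λ i → conflict (suc i) zero) (allFin (1 + n)) ≡ not (c ∧ b)
  column₀ = begin
    all (λ i → conflict (suc i) zero) (allFin (1 + n))
      ≡⟨ all-allFin-suc (λ i → conflict (suc i) zero) ⟩
    not (c ∧ b ∧ true) ∧ all (λ i → conflict (suc (suc i)) zero) (allFin n)
      ≡⟨ cong (not (c ∧ b ∧ true) ∧_) (all-true (λ i → not-∧-false (lookup S i) b) (allFin n)) ⟩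
    not (c ∧ b ∧ true) ∧ true
      ≡⟨ tidy c b ⟩
    not (c ∧ b)
      ∎
    where
    tidy : ∀ c b → not (c ∧ b ∧ true) ∧ true ≡ not (c ∧ b)
    tidy false b     = refl
    tidy true  false = refl
    tidy true  true  = refl

  absorb : ∀ b c z → not (b ∧ c) ∧ (not (c ∧ b) ∧ z) ≡ not (b ∧ c) ∧ z
  absorb false false z = refl
  absorb false true  z = refl
  absorb true  false z = refl
  absorb true  true  z = refl

independent-local : ∀ {n} (S : Subset n) → independentᵇ S ≡ noTwoConsecutive S
independent-local []          = refl
independent-local (false ∷ []) = refl
independent-local (true ∷ [])  = refl
independent-local (b ∷ c ∷ S) =
  trans (independent-cons₂ b c S) (cong (not (b ∧ c) ∧_) (independent-local (c ∷ S)))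

-- To make it inductive we allow an
-- extra vertex to the left of S, whose membership in the set is p; that
-- vertex may dominate the first vertex of S but need not be dominated itself.

dominatedAfter : ∀ {n} → Bool → Subset n → Bool
dominatedAfter {n} p S = all dominated (allFin n)
  where
  dominated : Fin n → Bool
  dominated v =
    lookup S v ∨ (p ∧ adjP {suc n} zero (suc v)) ∨ any (λ u → lookup S u ∧ adjP u v) (allFin n)

dominating-dominatedAfter : ∀ {n} (S : Subset n) → dominatingᵇ S ≡ dominatedAfter false S
dominating-dominatedAfter S = refl

coveredAfter : ∀ {n} → Bool → Subset n → Bool
coveredAfter p []          = true
coveredAfter p (b ∷ [])    = b ∨ p
coveredAfter p (b ∷ c ∷ S) = (b ∨ p ∨ c) ∧ coveredAfter b (c ∷ S)

dominatedAfter-[b] : ∀ p b → dominatedAfter p (b ∷ []) ≡ b ∨ p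
dominatedAfter-[b] false false = refl
dominatedAfter-[b] true  false = refl
dominatedAfter-[b] p     true  = refl

dominatedAfter-cons₂ : ∀ {n} p b c (S : Subset n) →
                       dominatedAfter p (b ∷ c ∷ S) ≡ (b ∨ p ∨ c) ∧ dominatedAfter b (c ∷ S)
dominatedAfter-cons₂ {n} p b c S =
  trans (all-allFin-suc dominated) (cong₂ _∧_ first-vertex (all-cong rest (allFin (1 + n))))
  where
  open ≡-Reasoning
  V : Subset (2 + n)
  V = b ∷ c ∷ S

  neighbourIn : Fin (2 + n) → Bool
  neighbourIn v = any (λ u → lookup V u ∧ adjP u v) (allFin (2 + n))

  dominated : Fin (2 + n) → Bool
  dominated v = lookup V v ∨ (p ∧ adjP {3 + n} zero (suc v)) ∨ neighbourIn v

  first-vertex : dominated zero ≡ b ∨ p ∨ c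
  first-vertex = begin
    b ∨ (p ∧ true) ∨ neighbourIn zero
      ≡⟨ cong (λ t → b ∨ (p ∧ true) ∨ t) (any-allFin-suc (λ u → lookup V u ∧ adjP u zero)) ⟩
    b ∨ (p ∧ true) ∨ ((b ∧ false) ∨ any (λ u → lookup (c ∷ S) u ∧ adjP (suc u) zero) (allFin (1 + n)))
      ≡⟨ cong (λ t → b ∨ (p ∧ true) ∨ ((b ∧ false) ∨ t))
              (any-allFin-suc (λ u → lookup (c ∷ S) u ∧ adjP (suc u) zero)) ⟩
    b ∨ (p ∧ true) ∨ ((b ∧ false) ∨ ((c ∧ true) ∨ any (λ u → lookup S u ∧ false) (allFin n)))
      ≡⟨ cong (λ t → b ∨ (p ∧ true) ∨ ((b ∧ false) ∨ ((c ∧ true) ∨ t)))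
              (any-false (λ u → ∧-zeroʳ (lookup S u)) (allFin n)) ⟩
    b ∨ (p ∧ true) ∨ ((b ∧ false) ∨ ((c ∧ true) ∨ false))
      ≡⟨ tidy b p c ⟩
    b ∨ p ∨ c
      ∎
    where
    tidy : ∀ b p c → b ∨ (p ∧ true) ∨ ((b ∧ false) ∨ ((c ∧ true) ∨ false)) ≡ b ∨ p ∨ c
    tidy true  p     c     = refl
    tidy false true  c     = refl
    tidy false false false = refl
    tidy false false true  = refl

  -- p is not adjacent to the later vertices; u = 0 contributes the new left neighbour b
  rest : ∀ v → dominated (suc v) ≡
         lookup (c ∷ S) v ∨ (b ∧ adjP {2 + n} zero (suc v))
           ∨ any (λ u → lookup (c ∷ S) u ∧ adjP u v) (allFin (1 + n))
  rest v = cong (lookup (c ∷ S) v ∨_)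
                (trans (drop-false p _) (any-allFin-suc (λ u → lookup V u ∧ adjP u (suc v))))
    where
    drop-false : ∀ p x → (p ∧ false) ∨ x ≡ x
    drop-false false x = refl
    drop-false true  x = refl

dominatedAfter-local : ∀ {n} p (S : Subset n) → dominatedAfter p S ≡ coveredAfter p S
dominatedAfter-local p []          = refl
dominatedAfter-local p (b ∷ [])    = dominatedAfter-[b] p b
dominatedAfter-local p (b ∷ c ∷ S) =
  trans (dominatedAfter-cons₂ p b c S) (cong ((b ∨ p ∨ c) ∧_) (dominatedAfter-local b (c ∷ S)))

isIndDomₗ : ∀ {n} → Subset n → Bool
isIndDomₗ S = noTwoConsecutive S ∧ coveredAfter false S

isIndDom-local : ∀ {n} (S : Subset n) → isIndDomᵇ S ≡ isIndDomₗ S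
isIndDom-local S =
  cong₂ _∧_ (independent-local S) (trans (dominating-dominatedAfter S) (dominatedAfter-local false S))

count : ∀ n → (Subset n → Bool) → ℕ
count n P = length (filterᵇ P (subsets n))

length-filterᵇ-map : ∀ {A B : Set} (P : B → Bool) (f : A → B) xs →
                     length (filterᵇ P (map f xs)) ≡ length (filterᵇ (P ∘ f) xs)
length-filterᵇ-map P f []       = refl
length-filterᵇ-map P f (x ∷ xs) with P (f x)
... | true  = cong suc (length-filterᵇ-map P f xs)
... | false = length-filterᵇ-map P f xs

count-suc : ∀ n (P : Subset (suc n) → Bool) →
            count (suc n) P ≡ count n (λ S → P (true ∷ S)) + count n (λ S → P (false ∷ S))
count-suc n P = begin
  length (filterᵇ P (map (true ∷_) (subsets n) ++ map (false ∷_) (subsets n)))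
    ≡⟨ cong length (filter-++ (T? ∘ P) (map (true ∷_) (subsets n)) _) ⟩
  length (filterᵇ P (map (true ∷_) (subsets n)) ++ filterᵇ P (map (false ∷_) (subsets n)))
    ≡⟨ length-++ (filterᵇ P (map (true ∷_) (subsets n))) ⟩
  length (filterᵇ P (map (true ∷_) (subsets n))) + length (filterᵇ P (map (false ∷_) (subsets n)))
    ≡⟨ cong₂ _+_ (length-filterᵇ-map P (true ∷_) (subsets n))
                 (length-filterᵇ-map P (false ∷_) (subsets n)) ⟩
  count n (λ S → P (true ∷ S)) + count n (λ S → P (false ∷ S))
    ∎
  where open ≡-Reasoning

count-cong : ∀ n {P Q : Subset n → Bool} → (∀ S → P S ≡ Q S) → count n P ≡ count n Q
count-cong n {P} {Q} e =
  cong length (filter-≐ (T? ∘ P) (T? ∘ Q)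
                        ((λ {S} → subst T (e S)) , (λ {S} → subst T (sym (e S))))
                        (subsets n))

count-none : ∀ n {P : Subset n → Bool} → (∀ S → P S ≡ false) → count n P ≡ 0
count-none n {P} e = cong length (filter-none (T? ∘ P) (universal (λ S → subst T (e S)) (subsets n)))

ofSize : ∀ {n} → ℕ → Subset n → Bool
ofSize k S = isIndDomₗ S ∧ (∣ S ∣ ≡ᵇ k)

di-local : ∀ n k → di n k ≡ count n (ofSize k)
di-local n k = count-cong n λ S → cong (_∧ (∣ S ∣ ≡ᵇ k)) (isIndDom-local S)

di-empty : ∀ m → di (suc m) 0 ≡ 0
di-empty m = trans (di-local (suc m) 0) (count-none (suc m) nonempty)
  where
  nonempty : (S : Subset (suc m)) → ofSize 0 S ≡ false
  nonempty (true ∷ S)          = ∧-zeroʳ (isIndDomₗ (true ∷ S))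
  nonempty (false ∷ [])        = refl
  nonempty (false ∷ true ∷ S)  = ∧-zeroʳ (isIndDomₗ (false ∷ true ∷ S))
  nonempty (false ∷ false ∷ S) =
    cong (_∧ (∣ S ∣ ≡ᵇ 0)) (∧-zeroʳ (noTwoConsecutive (false ∷ false ∷ S)))

-- d_i(P_{m+4}, k+1) = d_i(P_{m+2}, k) + d_i(P_{m+1}, k), by the start of S:
-- 1 1 is not independent, 0 0 leaves vertex 0 undominated, 0 1 1 is not
-- independent, while 1 0 and 0 1 0 leave an arbitrary independent dominating
-- set of the remaining path (its first vertex needs no help from the left).
di-recurrence : ∀ m k → di (4 + m) (suc k) ≡ di (2 + m) k + di (1 + m) k
di-recurrence m k = begin
  di (4 + m) (suc k)
    ≡⟨ di-local (4 + m) (suc k) ⟩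
  count (4 + m) P
    ≡⟨ count-suc (3 + m) P ⟩
  count (3 + m) (λ S → P (true ∷ S)) + count (3 + m) (λ S → P (false ∷ S))
    ≡⟨ cong₂ _+_ starts-with-1 starts-with-0 ⟩
  count (2 + m) (ofSize k) + count (1 + m) (ofSize k)
    ≡⟨ sym (cong₂ _+_ (di-local (2 + m) k) (di-local (1 + m) k)) ⟩
  di (2 + m) k + di (1 + m) k
    ∎
  where
  open ≡-Reasoning
  P : Subset (4 + m) → Bool
  P = ofSize (suc k)

  starts-with-1 : count (3 + m) (λ S → P (true ∷ S)) ≡ count (2 + m) (ofSize k)
  starts-with-1 = begin
    count (3 + m) (λ S → P (true ∷ S))
      ≡⟨ count-suc (2 + m) (λ S → P (true ∷ S)) ⟩
    count (2 + m) (λ S → P (true ∷ true ∷ S)) + count (2 + m) (λ S → P (true ∷ false ∷ S))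
      ≡⟨ cong₂ _+_ (count-none (2 + m) 1-1) (count-cong (2 + m) 1-0) ⟩
    count (2 + m) (ofSize k)
      ∎
    where
    1-1 : (S : Subset (2 + m)) → P (true ∷ true ∷ S) ≡ false
    1-1 (_ ∷ _) = refl
    1-0 : (S : Subset (2 + m)) → P (true ∷ false ∷ S) ≡ ofSize k S
    1-0 (_ ∷ _) = refl

  starts-with-0 : count (3 + m) (λ S → P (false ∷ S)) ≡ count (1 + m) (ofSize k)
  starts-with-0 = begin
    count (3 + m) (λ S → P (false ∷ S))
      ≡⟨ count-suc (2 + m) (λ S → P (false ∷ S)) ⟩
    count (2 + m) (λ S → P (false ∷ true ∷ S)) + count (2 + m) (λ S → P (false ∷ false ∷ S))
      ≡⟨ cong₂ _+_ (count-suc (1 + m) (λ S → P (false ∷ true ∷ S))) (count-none (2 + m) 0-0) ⟩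
    count (1 + m) (λ S → P (false ∷ true ∷ true ∷ S))
      + count (1 + m) (λ S → P (false ∷ true ∷ false ∷ S)) + 0
      ≡⟨ cong (_+ 0) (cong₂ _+_ (count-none (1 + m) 0-1-1) (count-cong (1 + m) 0-1-0)) ⟩
    count (1 + m) (ofSize k) + 0
      ≡⟨ ℕP.+-identityʳ _ ⟩
    count (1 + m) (ofSize k)
      ∎
    where
    0-0 : (S : Subset (2 + m)) → P (false ∷ false ∷ S) ≡ false
    0-0 (d ∷ S) =
      cong (_∧ (∣ d ∷ S ∣ ≡ᵇ suc k)) (∧-zeroʳ (noTwoConsecutive (false ∷ false ∷ d ∷ S)))
    0-1-1 : (S : Subset (1 + m)) → P (false ∷ true ∷ true ∷ S) ≡ false
    0-1-1 S = refl
    0-1-0 : (S : Subset (1 + m)) → P (false ∷ true ∷ false ∷ S) ≡ ofSize k S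
    0-1-0 (_ ∷ _) = refl

⊛-⊛X : ∀ f g → f ⊛ (g ⊛ X) ≐ shX (f ⊛ g)
⊛-⊛X f g = begin
  f ⊛ (g ⊛ X)    ≈⟨ ⊛-congˡ f (⊛-X g) ⟩
  f ⊛ shX g      ≈⟨ ⊛-shX f g ⟩
  shX (f ⊛ g)    ∎
  where open ≐-Reasoning

⊛-⊛Y : ∀ f g → f ⊛ (g ⊛ Y) ≐ shY (f ⊛ g)
⊛-⊛Y f g = begin
  f ⊛ (g ⊛ Y)    ≈⟨ ⊛-congˡ f (⊛-Y g) ⟩
  f ⊛ shY g      ≈⟨ ⊛-shY f g ⟩
  shY (f ⊛ g)    ∎
  where open ≐-Reasoning

⊛-onePlusX : ∀ f → f ⊛ (one ⊕ X) ≐ f ⊕ shX f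
⊛-onePlusX f = begin
  f ⊛ (one ⊕ X)        ≈⟨ ⊛-distribˡ-⊕ f one X ⟩
  f ⊛ one ⊕ f ⊛ X      ≈⟨ ⊕-cong (⊛-identityʳ f) (⊛-X f) ⟩
  f ⊕ shX f            ∎
  where open ≐-Reasoning

x[1+x] : PS
x[1+x] = X ⊕ shX X

numer-shifts : numer ≐ shY (x[1+x] ⊕ shX x[1+x])
numer-shifts = begin
  X ⊛ (one ⊕ X) ⊛ (one ⊕ X) ⊛ Y
    ≈⟨ ⊛-Y (X ⊛ (one ⊕ X) ⊛ (one ⊕ X)) ⟩
  shY (X ⊛ (one ⊕ X) ⊛ (one ⊕ X))
    ≈⟨ shY-cong (⊛-onePlusX (X ⊛ (one ⊕ X))) ⟩
  shY (X ⊛ (one ⊕ X) ⊕ shX (X ⊛ (one ⊕ X)))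
    ≈⟨ shY-cong (⊕-cong (⊛-onePlusX X) (shX-cong (⊛-onePlusX X))) ⟩
  shY (x[1+x] ⊕ shX x[1+x])
    ∎
  where open ≐-Reasoning

F⊛denom-shifts : F ⊛ denom ≐ F ⊖ shY (shX (shX F) ⊕ shX (shX (shX F)))
F⊛denom-shifts = begin
  F ⊛ (one ⊖ (X ⊛ X ⊕ X ⊛ X ⊛ X) ⊛ Y)
    ≈⟨ ⊛-distribˡ-⊖ F one ((X ⊛ X ⊕ X ⊛ X ⊛ X) ⊛ Y) ⟩
  F ⊛ one ⊖ F ⊛ ((X ⊛ X ⊕ X ⊛ X ⊛ X) ⊛ Y)
    ≈⟨ ⊖-cong (⊛-identityʳ F) (⊛-⊛Y F (X ⊛ X ⊕ X ⊛ X ⊛ X)) ⟩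
  F ⊖ shY (F ⊛ (X ⊛ X ⊕ X ⊛ X ⊛ X))
    ≈⟨ ⊖-cong (≐-refl {F}) (shY-cong (⊛-distribˡ-⊕ F (X ⊛ X) (X ⊛ X ⊛ X))) ⟩
  F ⊖ shY (F ⊛ (X ⊛ X) ⊕ F ⊛ (X ⊛ X ⊛ X))
    ≈⟨ ⊖-cong (≐-refl {F}) (shY-cong (⊕-cong F⊛x² F⊛x³)) ⟩
  F ⊖ shY (shX (shX F) ⊕ shX (shX (shX F)))
    ∎
  where
  open ≐-Reasoning
  F⊛x² : F ⊛ (X ⊛ X) ≐ shX (shX F)
  F⊛x² = ≐-trans (⊛-⊛X F X) (shX-cong (⊛-X F))
  F⊛x³ : F ⊛ (X ⊛ X ⊛ X) ≐ shX (shX (shX F))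
  F⊛x³ = ≐-trans (⊛-⊛X F (X ⊛ X)) (shX-cong F⊛x²)

-- Coefficientwise the identity is the recurrence for d_i(P_n, k); the
-- coefficients with n ≤ 3 are checked by evaluating d_i on small paths.
coefficients-agree : ∀ n k →
  (F ⊖ shY (shX (shX F) ⊕ shX (shX (shX F)))) n k ≡ shY (x[1+x] ⊕ shX x[1+x]) n k
coefficients-agree zero    zero                = refl
coefficients-agree (suc n) zero                = refl
coefficients-agree zero    (suc k)             = refl
coefficients-agree 1       (suc zero)          = refl
coefficients-agree 1       (suc (suc k))       = refl
coefficients-agree 2       (suc zero)          = refl
coefficients-agree 2       (suc (suc k))       = refl
coefficients-agree 3       (suc zero)          = refl
coefficients-agree 3       (suc (suc zero))    = refl
coefficients-agree 3       (suc (suc (suc k))) = refl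
coefficients-agree (suc (suc (suc (suc m)))) (suc zero)
  rewrite di-recurrence m 0 | di-empty (suc m) | di-empty m = refl
coefficients-agree (suc (suc (suc (suc m)))) (suc (suc k))
  rewrite di-recurrence m (suc k) = ℤP.+-inverseʳ (+ (di (2 + m) (suc k) + di (1 + m) (suc k)))

mainTheorem11 : ∀ n k → (F ⊛ denom) n k ≡ numer n k
mainTheorem11 n k =
  trans (coeff F⊛denom-shifts n k) (trans (coefficients-agree n k) (sym (coeff numer-shifts n k)))
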